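{- Let $f,g\colon\mathcal{P}(\omega)\to\mathcal{P}(\omega)$ be such that for every $x$, $f(x)$ and $g(x)$ are $\Pi^1_1(x)$, uniformly in $x$. Assume moreover that $g$ is monotone with respect to $\subseteq$. Then, for every $x$, $g(f(x))$ is $\Pi^1_1(x)$, uniformly in $x$.
   Context: "$f(x)$ is $\Pi^1_1(x)$ uniformly in $x$" means there is a single $\Pi^1_1$ formula $\varphi(n,X)$ such that for all $x\subseteq\omega$ and $n\in\omega$, $n\in f(x)\iff\varphi(n,x)$. -}

module Defs where

open import Data.Nat using (ℕ; zero; suc; _+_; _*_)
open import Data.Fin using (Fin)
open import Data.Bool using (Bool; true)
open import Data.Product using (_×_; Σ)
open import Data.Sum using (_⊎_)
open import Data.Empty using (⊥)
open import Relation.Binary.PropositionalEquality using (_≡_)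
open import Function.Bundles using (_⇔_)

-- Subsets of ω are characteristic functions ℕ → Bool (with LEM this is the full powerset).
Subset : Set
Subset = ℕ → Bool

_∈ₛ_ : ℕ → Subset → Set
n ∈ₛ X = X n ≡ true

_⊆ₛ_ : Subset → Subset → Set
X ⊆ₛ Y = ∀ n → n ∈ₛ X → n ∈ₛ Y

data Term (nv : ℕ) : Set where
  var  : Fin nv → Term nv
  zer  : Term nv
  succ : Term nv → Term nv
  plus : Term nv → Term nv → Term nv
  mult : Term nv → Term nv → Term nv

data Arith (nv sv : ℕ) : Set where
  eq   : Term nv → Term nv → Arith nv sv
  mem  : Term nv → Fin sv → Arith nv sv
  neg  : Arith nv sv → Arith nv sv
  conj : Arith nv sv → Arith nv sv → Arith nv sv
  disj : Arith nv sv → Arith nv sv → Arith nv sv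
  allN : Arith (suc nv) sv → Arith nv sv
  exN  : Arith (suc nv) sv → Arith nv sv

data Pi11 (nv sv : ℕ) : Set where
  arith : Arith nv sv → Pi11 nv sv
  allS  : Pi11 nv (suc sv) → Pi11 nv sv

NEnv : ℕ → Set
NEnv nv = Fin nv → ℕ

SEnv : ℕ → Set
SEnv sv = Fin sv → Subset

extend : {A : Set} {k : ℕ} → A → (Fin k → A) → Fin (suc k) → A
extend a ρ Fin.zero = a
extend a ρ (Fin.suc i) = ρ i

evalT : {nv : ℕ} → NEnv nv → Term nv → ℕ
evalT ρ (var i) = ρ i
evalT ρ zer = zero
evalT ρ (succ t) = suc (evalT ρ t)
evalT ρ (plus s t) = evalT ρ s + evalT ρ t
evalT ρ (mult s t) = evalT ρ s * evalT ρ t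

⟦_⟧A : {nv sv : ℕ} → Arith nv sv → NEnv nv → SEnv sv → Set
⟦ eq s t ⟧A ρ σ = evalT ρ s ≡ evalT ρ t
⟦ mem t i ⟧A ρ σ = evalT ρ t ∈ₛ σ i
⟦ neg φ ⟧A ρ σ = ⟦ φ ⟧A ρ σ → ⊥
⟦ conj φ ψ ⟧A ρ σ = ⟦ φ ⟧A ρ σ × ⟦ ψ ⟧A ρ σ
⟦ disj φ ψ ⟧A ρ σ = ⟦ φ ⟧A ρ σ ⊎ ⟦ ψ ⟧A ρ σ
⟦ allN φ ⟧A ρ σ = (m : ℕ) → ⟦ φ ⟧A (extend m ρ) σ
⟦ exN φ ⟧A ρ σ = Σ ℕ (λ m → ⟦ φ ⟧A (extend m ρ) σ)

⟦_⟧P : {nv sv : ℕ} → Pi11 nv sv → NEnv nv → SEnv sv → Set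
⟦ arith φ ⟧P ρ σ = ⟦ φ ⟧A ρ σ
⟦ allS φ ⟧P ρ σ = (Y : Subset) → ⟦ φ ⟧P ρ (extend Y σ)

sat : Pi11 1 1 → ℕ → Subset → Set
sat φ n x = ⟦ φ ⟧P (λ _ → n) (λ _ → x)

UniformlyPi11 : (Subset → Subset) → Set
UniformlyPi11 f = Σ (Pi11 1 1) (λ φ → ∀ (x : Subset) (n : ℕ) → (n ∈ₛ f x) ⇔ sat φ n x)

Monotone : (Subset → Subset) → Set
Monotone g = ∀ (x y : Subset) → x ⊆ₛ y → g x ⊆ₛ g y

-- Classical metatheory (the paper works in ZFC)
ExcludedMiddle : Set₁
ExcludedMiddle = (P : Set) → P ⊎ (P → ⊥)

{-# OPTIONS --safe #-}
-- For monotone g, n ∈ g (f x) iff every Y either misses some m ∈ f x or has n ∈ g Y.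
-- Reading f and g through their Π¹₁ definitions this is
--   ∀Y. (∃m. φf(m,x) ∧ m ∉ Y) ∨ φg(n,Y),
-- so it suffices that Π¹₁ is closed under substitution, conjunction with an arithmetical
-- formula, disjunction and the number quantifier ∃m.  Only the last needs an idea:
-- classically ∃m ∀Z ψ(m,Z) ⇔ ∀W ∃m ψ(m,(W)ₘ), where (W)ₘ = {k | ⟨m,k⟩ ∈ W} for the
-- polynomial pairing ⟨m,k⟩ = (m+k)² + m; for ⇐, counterexamples Zₘ are glued into one W.
module Submission where

open import Defs
open import Function.Base using (_∘_; id)
open import Axiom.DoubleNegationElimination using (DoubleNegationElimination; em⇒dne)
open import Data.Bool using (false)
open import Data.Fin using (Fin; zero; suc; lift)
open import Data.Nat using (ℕ; suc; _+_; _*_; _≤_; _<_)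
open import Data.Nat.Properties
open import Data.Product using (_×_; _,_; proj₁; proj₂; ∃; ∃₂)
open import Data.Product.Function.Dependent.Propositional using (Σ-⇔)
open import Data.Product.Function.NonDependent.Propositional using (_×-⇔_)
open import Data.Sum using (_⊎_; inj₁; inj₂; [_,_]; fromInj₂; swap)
open import Data.Sum.Function.Propositional using (_⊎-⇔_)
open import Function.Bundles using (_⇔_; mk⇔; Equivalence)
open import Function.Construct.Identity using (↠-id; ⇔-id)
open import Function.Properties.Equivalence using () renaming (trans to ⇔-trans; sym to ⇔-sym)
open import Function.Related.TypeIsomorphisms using (¬-cong-⇔)
open import Relation.Binary using (tri<; tri≈; tri>)
open import Relation.Binary.PropositionalEquality
  using (_≡_; refl; sym; trans; cong; cong₂; _≗_)
open import Relation.Nullary using (¬_; contradiction)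
open import Relation.Nullary.Decidable using (fromSum)
open import Relation.Nullary.Negation using (¬∃⟶∀¬)

open Equivalence using (to; from)

private variable
  nv nv' sv sv' : ℕ

Π-⇔ : {A : Set} {P Q : A → Set} → (∀ x → P x ⇔ Q x) → (∀ x → P x) ⇔ (∀ x → Q x)
Π-⇔ P⇔Q = mk⇔ (λ p x → to (P⇔Q x) (p x)) (λ q x → from (P⇔Q x) (q x))

∃-⇔ : {A : Set} {P Q : A → Set} → (∀ x → P x ⇔ Q x) → ∃ P ⇔ ∃ Q
∃-⇔ P⇔Q = Σ-⇔ (↠-id _) (λ {x} → P⇔Q x)

pair : ℕ → ℕ → ℕ
pair a b = (a + b) * (a + b) + a

a≤s<t⇒s*s+a<t*t+b : ∀ {a b s t} → a ≤ s → s < t → s * s + a < t * t + b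
a≤s<t⇒s*s+a<t*t+b {a} {b} {s} {t} a≤s s<t = begin-strict
  s * s + a              ≤⟨ +-monoʳ-≤ (s * s) a≤s ⟩
  s * s + s              ≡⟨ +-comm (s * s) s ⟩
  s + s * s              ≤⟨ m≤n+m (s + s * s) s ⟩
  s + (s + s * s)        <⟨ n<1+n _ ⟩
  suc (s + (s + s * s))  ≡⟨ cong (λ u → suc (s + u)) (sym (*-suc s s)) ⟩
  suc s * suc s          ≤⟨ *-mono-≤ s<t s<t ⟩
  t * t                  ≤⟨ m≤m+n (t * t) b ⟩
  t * t + b              ∎
  where open ≤-Reasoning

pair-injective : ∀ {a b a' b'} → pair a b ≡ pair a' b' → a ≡ a' × b ≡ b'
pair-injective {a} {b} {a'} {b'} e with <-cmp (a + b) (a' + b')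
... | tri< lt _ _ = contradiction e (<⇒≢ (a≤s<t⇒s*s+a<t*t+b (m≤m+n a b) lt))
... | tri> _ _ gt = contradiction (sym e) (<⇒≢ (a≤s<t⇒s*s+a<t*t+b (m≤m+n a' b') gt))
... | tri≈ _ s≡s' _ = a≡a' , +-cancelˡ-≡ a' b b' (trans (cong (_+ b) (sym a≡a')) s≡s')
  where
  a≡a' : a ≡ a'
  a≡a' = +-cancelˡ-≡ ((a' + b') * (a' + b')) a a' (trans (cong (λ s → s * s + a) (sym s≡s')) e)

pairT : Term nv → Term nv → Term nv
pairT s t = plus (mult (plus s t) (plus s t)) s

renameT : (Fin nv → Fin nv') → Term nv → Term nv'
renameT r (var i)    = var (r i)
renameT r zer        = zer
renameT r (succ t)   = succ (renameT r t)
renameT r (plus s t) = plus (renameT r s) (renameT r t)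
renameT r (mult s t) = mult (renameT r s) (renameT r t)

renameT-sound : {r : Fin nv → Fin nv'} {ρ : NEnv nv} {ρ' : NEnv nv'} →
  ρ' ∘ r ≗ ρ → ∀ t → evalT ρ' (renameT r t) ≡ evalT ρ t
renameT-sound hr (var i)    = hr i
renameT-sound hr zer        = refl
renameT-sound hr (succ t)   = cong suc (renameT-sound hr t)
renameT-sound hr (plus s t) = cong₂ _+_ (renameT-sound hr s) (renameT-sound hr t)
renameT-sound hr (mult s t) = cong₂ _*_ (renameT-sound hr s) (renameT-sound hr t)

extend-lift : {r : Fin nv → Fin nv'} {ρ : NEnv nv} {ρ' : NEnv nv'} →
  ρ' ∘ r ≗ ρ → ∀ m → extend m ρ' ∘ lift 1 r ≗ extend m ρ
extend-lift hr m zero    = refl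
extend-lift hr m (suc i) = hr i

section : ℕ → Subset → Subset
section m X k = X (pair m k)

data SetExpr (nv sv : ℕ) : Set where
  setVar     : Fin sv → SetExpr nv sv
  sectionVar : Fin nv → Fin sv → SetExpr nv sv

⟦_⟧ˢ : SetExpr nv sv → NEnv nv → SEnv sv → Subset
⟦ setVar j ⟧ˢ       ρ σ = σ j
⟦ sectionVar m j ⟧ˢ ρ σ = section (ρ m) (σ j)

weakenᴺ : SetExpr nv sv → SetExpr (suc nv) sv
weakenᴺ (setVar j)       = setVar j
weakenᴺ (sectionVar m j) = sectionVar (suc m) j

weakenˢ : SetExpr nv sv → SetExpr nv (suc sv)
weakenˢ (setVar j)       = setVar (suc j)
weakenˢ (sectionVar m j) = sectionVar m (suc j)

weakenᴺ-sound : ∀ (e : SetExpr nv sv) {m ρ σ} → ⟦ weakenᴺ e ⟧ˢ (extend m ρ) σ ≗ ⟦ e ⟧ˢ ρ σ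
weakenᴺ-sound (setVar j)       _ = refl
weakenᴺ-sound (sectionVar m j) _ = refl

weakenˢ-sound : ∀ (e : SetExpr nv sv) {ρ Y σ} → ⟦ weakenˢ e ⟧ˢ ρ (extend Y σ) ≗ ⟦ e ⟧ˢ ρ σ
weakenˢ-sound (setVar j)       _ = refl
weakenˢ-sound (sectionVar m j) _ = refl

extendˢ : SetExpr nv (suc sv') → (Fin sv → SetExpr nv sv') → Fin (suc sv) → SetExpr nv (suc sv')
extendˢ e a = extend e (weakenˢ ∘ a)

extendˢ-agrees : ∀ {e : SetExpr nv (suc sv')} {a : Fin sv → SetExpr nv sv'} {ρ σ' σ Y Z} →
  ⟦ e ⟧ˢ ρ (extend Y σ') ≗ Z → (∀ i → ⟦ a i ⟧ˢ ρ σ' ≗ σ i) →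
  ∀ i → ⟦ extendˢ e a i ⟧ˢ ρ (extend Y σ') ≗ extend Z σ i
extendˢ-agrees he ha zero    = he
extendˢ-agrees {a = a} he ha (suc i) k = trans (weakenˢ-sound (a i) k) (ha i k)

_∈ᴱ_ : Term nv → SetExpr nv sv → Arith nv sv
t ∈ᴱ setVar j       = mem t j
t ∈ᴱ sectionVar m j = mem (pairT (var m) t) j

∈ᴱ-sound : ∀ (t : Term nv) (e : SetExpr nv sv) {ρ σ} → ⟦ t ∈ᴱ e ⟧A ρ σ ⇔ (evalT ρ t ∈ₛ ⟦ e ⟧ˢ ρ σ)
∈ᴱ-sound t (setVar j)       = ⇔-id _
∈ᴱ-sound t (sectionVar m j) = ⇔-id _

≡-resp : ∀ {a b c d : ℕ} → a ≡ c → b ≡ d → (a ≡ b) ⇔ (c ≡ d)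
≡-resp refl refl = ⇔-id _

∈ₛ-resp : ∀ {m n} (X Y : Subset) → m ≡ n → X n ≡ Y n → (m ∈ₛ X) ⇔ (n ∈ₛ Y)
∈ₛ-resp X Y refl Xn≡Yn rewrite Xn≡Yn = ⇔-id _

substA : (Fin nv → Fin nv') → (Fin sv → SetExpr nv' sv') → Arith nv sv → Arith nv' sv'
substA r a (eq s t)   = eq (renameT r s) (renameT r t)
substA r a (mem t i)  = renameT r t ∈ᴱ a i
substA r a (neg A)    = neg (substA r a A)
substA r a (conj A B) = conj (substA r a A) (substA r a B)
substA r a (disj A B) = disj (substA r a A) (substA r a B)
substA r a (allN A)   = allN (substA (lift 1 r) (weakenᴺ ∘ a) A)
substA r a (exN A)    = exN (substA (lift 1 r) (weakenᴺ ∘ a) A)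

substA-sound : {r : Fin nv → Fin nv'} {a : Fin sv → SetExpr nv' sv'}
  {ρ : NEnv nv} {ρ' : NEnv nv'} {σ : SEnv sv} {σ' : SEnv sv'} →
  ρ' ∘ r ≗ ρ → (∀ i → ⟦ a i ⟧ˢ ρ' σ' ≗ σ i) →
  ∀ A → ⟦ substA r a A ⟧A ρ' σ' ⇔ ⟦ A ⟧A ρ σ
substA-sound hr ha (eq s t) = ≡-resp (renameT-sound hr s) (renameT-sound hr t)
substA-sound {r = r} {a} {ρ' = ρ'} {σ} {σ'} hr ha (mem t i) =
  ⇔-trans (∈ᴱ-sound (renameT r t) (a i))
          (∈ₛ-resp (⟦ a i ⟧ˢ ρ' σ') (σ i) (renameT-sound {r = r} {ρ' = ρ'} hr t) (ha i _))
substA-sound hr ha (neg A)    = ¬-cong-⇔ (substA-sound hr ha A)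
substA-sound hr ha (conj A B) = substA-sound hr ha A ×-⇔ substA-sound hr ha B
substA-sound hr ha (disj A B) = substA-sound hr ha A ⊎-⇔ substA-sound hr ha B
substA-sound {a = a} hr ha (allN A) =
  Π-⇔ λ m → substA-sound (extend-lift hr m) (λ i k → trans (weakenᴺ-sound (a i) k) (ha i k)) A
substA-sound {a = a} hr ha (exN A) =
  ∃-⇔ λ m → substA-sound (extend-lift hr m) (λ i k → trans (weakenᴺ-sound (a i) k) (ha i k)) A

substP : (Fin nv → Fin nv') → (Fin sv → SetExpr nv' sv') → Pi11 nv sv → Pi11 nv' sv'
substP r a (arith A) = arith (substA r a A)
substP r a (allS φ)  = allS (substP r (extendˢ (setVar zero) a) φ)

substP-sound : {r : Fin nv → Fin nv'} {a : Fin sv → SetExpr nv' sv'}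
  {ρ : NEnv nv} {ρ' : NEnv nv'} {σ : SEnv sv} {σ' : SEnv sv'} →
  ρ' ∘ r ≗ ρ → (∀ i → ⟦ a i ⟧ˢ ρ' σ' ≗ σ i) →
  ∀ φ → ⟦ substP r a φ ⟧P ρ' σ' ⇔ ⟦ φ ⟧P ρ σ
substP-sound hr ha (arith A) = substA-sound hr ha A
substP-sound hr ha (allS φ) = Π-⇔ λ Y → substP-sound hr (extendˢ-agrees (λ _ → refl) ha) φ

weakenA : Arith nv sv → Arith nv (suc sv)
weakenA = substA id (setVar ∘ suc)

weakenP : Pi11 nv sv → Pi11 nv (suc sv)
weakenP = substP id (setVar ∘ suc)

weakenA-sound : ∀ (A : Arith nv sv) {ρ Y σ} → ⟦ weakenA A ⟧A ρ (extend Y σ) ⇔ ⟦ A ⟧A ρ σ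
weakenA-sound A = substA-sound (λ _ → refl) (λ _ _ → refl) A

weakenP-sound : ∀ (φ : Pi11 nv sv) {ρ Y σ} → ⟦ weakenP φ ⟧P ρ (extend Y σ) ⇔ ⟦ φ ⟧P ρ σ
weakenP-sound φ = substP-sound (λ _ → refl) (λ _ _ → refl) φ

infixl 6 _∧ᴬ_
infixl 5 _∨ᴬ_ _∨ᴾ_

_∧ᴬ_ : Pi11 nv sv → Arith nv sv → Pi11 nv sv
arith B ∧ᴬ A = arith (conj B A)
allS φ  ∧ᴬ A = allS (φ ∧ᴬ weakenA A)

∧ᴬ-sound : ∀ (φ : Pi11 nv sv) A {ρ σ} → ⟦ φ ∧ᴬ A ⟧P ρ σ ⇔ (⟦ φ ⟧P ρ σ × ⟦ A ⟧A ρ σ)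
∧ᴬ-sound (arith B) A = ⇔-id _
∧ᴬ-sound (allS φ)  A = ⇔-trans
  (Π-⇔ λ Y → ⇔-trans (∧ᴬ-sound φ (weakenA A)) (⇔-id _ ×-⇔ weakenA-sound A))
  (mk⇔ (λ h → proj₁ ∘ h , proj₂ (h (λ _ → false))) (λ (p , a) Y → p Y , a))

_∨ᴬ_ : Pi11 nv sv → Arith nv sv → Pi11 nv sv
arith B ∨ᴬ A = arith (disj B A)
allS φ  ∨ᴬ A = allS (φ ∨ᴬ weakenA A)

_∨ᴾ_ : Pi11 nv sv → Pi11 nv sv → Pi11 nv sv
φ ∨ᴾ arith A = φ ∨ᴬ A
φ ∨ᴾ allS ψ  = allS (weakenP φ ∨ᴾ ψ)

-- ∃m. φ with the set variables of φ read through a: each ∀Z of φ becomes ∀W with Z read as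
-- the m-th section of W.  Carrying a, rather than substituting, keeps the recursion structural.
∃ᴾ⟨_⟩_ : (Fin sv → SetExpr (suc nv) sv') → Pi11 (suc nv) sv → Pi11 nv sv'
∃ᴾ⟨ a ⟩ arith A = arith (exN (substA id a A))
∃ᴾ⟨ a ⟩ allS φ  = allS (∃ᴾ⟨ extendˢ (sectionVar zero zero) a ⟩ φ)

-- In compose the set variables are Y (index 0) and X (index 1); under ∃ᴾ the number
-- variables are m (index 0) and n (index 1).
_[m,X] : Pi11 1 1 → Pi11 2 2
φ [m,X] = substP (λ _ → zero) (λ _ → setVar (suc zero)) φ

_[n,Y] : Pi11 1 1 → Pi11 1 2
φ [n,Y] = substP id (λ _ → setVar zero) φ

m∉Y : Arith 2 2
m∉Y = neg (mem (var zero) zero)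

compose : Pi11 1 1 → Pi11 1 1 → Pi11 1 1
compose φf φg = allS ((∃ᴾ⟨ setVar ⟩ (φf [m,X] ∧ᴬ m∉Y)) ∨ᴾ φg [n,Y])

_⊈ₛ_ : Subset → Subset → Set
X ⊈ₛ Y = ∃ λ m → m ∈ₛ X × ¬ m ∈ₛ Y

module Classical (lem : ExcludedMiddle) where

  dne : DoubleNegationElimination _
  dne = em⇒dne (λ {P} → fromSum (lem P))

  ¬∀⇒∃¬ : {A : Set} {P : A → Set} → ¬ (∀ x → P x) → ∃ λ x → ¬ P x
  ¬∀⇒∃¬ ¬∀ = dne λ ∄ → ¬∀ λ x → dne (¬∃⟶∀¬ ∄ x)

  ∀-distribˡ-⊎ : {A P : Set} {Q : A → Set} → (∀ x → P ⊎ Q x) ⇔ (P ⊎ (∀ x → Q x))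
  ∀-distribˡ-⊎ {P = P} {Q} = mk⇔ to′ [ (λ p _ → inj₁ p) , (λ q x → inj₂ (q x)) ]
    where
    to′ : (∀ x → P ⊎ Q x) → P ⊎ (∀ x → Q x)
    to′ h with lem P
    ... | inj₁ p  = inj₁ p
    ... | inj₂ ¬p = inj₂ λ x → fromInj₂ (λ p → contradiction p ¬p) (h x)

  ∀-distribʳ-⊎ : {A P : Set} {Q : A → Set} → (∀ x → Q x ⊎ P) ⇔ ((∀ x → Q x) ⊎ P)
  ∀-distribʳ-⊎ = ⇔-trans (Π-⇔ λ _ → ⊎-swap) (⇔-trans ∀-distribˡ-⊎ ⊎-swap)
    where
    ⊎-swap : {A B : Set} → (A ⊎ B) ⇔ (B ⊎ A)
    ⊎-swap = mk⇔ swap swap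

  ∃∀-by-skolemisation : {I A : Set} {Q : I → A → Set} →
    (∀ (Z : I → A) → ∃ λ m → Q m (Z m)) → ∃ λ m → ∀ x → Q m x
  ∃∀-by-skolemisation h = dne λ ∄ →
    let counterexample m = ¬∀⇒∃¬ (¬∃⟶∀¬ ∄ m)
        (m , q) = h (proj₁ ∘ counterexample)
    in proj₂ (counterexample m) q

  code : (ℕ → Subset) → Subset
  code Z c with lem (∃₂ λ m k → pair m k ≡ c)
  ... | inj₁ (m , k , _) = Z m k
  ... | inj₂ _           = false

  section-code : ∀ Z m → section m (code Z) ≗ Z m
  section-code Z m k with lem (∃₂ λ m′ k′ → pair m′ k′ ≡ pair m k)
  ... | inj₁ (m′ , k′ , e) with pair-injective {m′} {k′} {m} {k} e
  ...   | refl , refl = refl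
  section-code Z m k | inj₂ ∄ = contradiction (m , k , refl) ∄

  ∨ᴬ-sound : ∀ (φ : Pi11 nv sv) A {ρ σ} → ⟦ φ ∨ᴬ A ⟧P ρ σ ⇔ (⟦ φ ⟧P ρ σ ⊎ ⟦ A ⟧A ρ σ)
  ∨ᴬ-sound (arith B) A = ⇔-id _
  ∨ᴬ-sound (allS φ)  A = ⇔-trans
    (Π-⇔ λ Y → ⇔-trans (∨ᴬ-sound φ (weakenA A)) (⇔-id _ ⊎-⇔ weakenA-sound A))
    ∀-distribʳ-⊎

  ∨ᴾ-sound : ∀ (φ ψ : Pi11 nv sv) {ρ σ} → ⟦ φ ∨ᴾ ψ ⟧P ρ σ ⇔ (⟦ φ ⟧P ρ σ ⊎ ⟦ ψ ⟧P ρ σ)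
  ∨ᴾ-sound φ (arith A) = ∨ᴬ-sound φ A
  ∨ᴾ-sound φ (allS ψ)  = ⇔-trans
    (Π-⇔ λ Y → ⇔-trans (∨ᴾ-sound (weakenP φ) ψ) (weakenP-sound φ ⊎-⇔ ⇔-id _))
    ∀-distribˡ-⊎

  ∃ᴾ-sound : ∀ (a : Fin sv → SetExpr (suc nv) sv') φ {ρ σ'} {σ : ℕ → SEnv sv} →
    (∀ m i → ⟦ a i ⟧ˢ (extend m ρ) σ' ≗ σ m i) →
    ⟦ ∃ᴾ⟨ a ⟩ φ ⟧P ρ σ' ⇔ ∃ λ m → ⟦ φ ⟧P (extend m ρ) (σ m)
  ∃ᴾ-sound a (arith A) ha = ∃-⇔ λ m → substA-sound (λ _ → refl) (ha m) A
  ∃ᴾ-sound a (allS φ) ha = mk⇔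
    (λ h → ∃∀-by-skolemisation λ Z →
      to (∃ᴾ-sound _ φ (λ m → extendˢ-agrees (section-code Z m) (ha m))) (h (code Z)))
    (λ (m , p) W →
      from (∃ᴾ-sound _ φ (λ m → extendˢ-agrees (λ _ → refl) (ha m))) (m , p (section m W)))

  Monotone⇒∈⇔∀⊈⊎∈ : {g : Subset → Subset} → Monotone g →
    ∀ X n → n ∈ₛ g X ⇔ (∀ Y → X ⊈ₛ Y ⊎ n ∈ₛ g Y)
  Monotone⇒∈⇔∀⊈⊎∈ {g} mono X n = mk⇔ to′ from′
    where
    to′ : n ∈ₛ g X → ∀ Y → X ⊈ₛ Y ⊎ n ∈ₛ g Y
    to′ n∈gX Y with lem (X ⊈ₛ Y)
    ... | inj₁ X⊈Y = inj₁ X⊈Y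
    ... | inj₂ ¬X⊈Y = inj₂ (mono X Y (λ m m∈X → dne λ m∉Y → ¬X⊈Y (m , m∈X , m∉Y)) n n∈gX)
    from′ : (∀ Y → X ⊈ₛ Y ⊎ n ∈ₛ g Y) → n ∈ₛ g X
    from′ h = fromInj₂ (λ (m , m∈X , m∉X) → contradiction m∈X m∉X) (h X)

  compose-sound : ∀ {f g : Subset → Subset} φf φg →
    (∀ x n → n ∈ₛ f x ⇔ sat φf n x) → (∀ y n → n ∈ₛ g y ⇔ sat φg n y) →
    ∀ x n → sat (compose φf φg) n x ⇔ (∀ Y → f x ⊈ₛ Y ⊎ n ∈ₛ g Y)
  compose-sound {f} {g} φf φg f≈φf g≈φg x n = Π-⇔ λ Y →
    ⇔-trans (∨ᴾ-sound (∃ᴾ⟨ setVar ⟩ (φf [m,X] ∧ᴬ m∉Y)) (φg [n,Y])) (⊈-part Y ⊎-⇔ ∈-part Y)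
    where
    ⊈-part : ∀ Y → ⟦ ∃ᴾ⟨ setVar ⟩ (φf [m,X] ∧ᴬ m∉Y) ⟧P (λ _ → n) (extend Y (λ _ → x)) ⇔ f x ⊈ₛ Y
    ⊈-part Y = ⇔-trans (∃ᴾ-sound setVar (φf [m,X] ∧ᴬ m∉Y) (λ _ _ _ → refl)) (∃-⇔ λ m →
      ⇔-trans (∧ᴬ-sound (φf [m,X]) m∉Y)
        (⇔-trans (substP-sound (λ _ → refl) (λ _ _ → refl) φf) (⇔-sym (f≈φf x m)) ×-⇔ ⇔-id _))
    ∈-part : ∀ Y → ⟦ φg [n,Y] ⟧P (λ _ → n) (extend Y (λ _ → x)) ⇔ n ∈ₛ g Y
    ∈-part Y = ⇔-trans (substP-sound (λ _ → refl) (λ _ _ → refl) φg) (⇔-sym (g≈φg Y n))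

lemma2p5 : ExcludedMiddle → (f g : Subset → Subset) →
    UniformlyPi11 f → UniformlyPi11 g → Monotone g → UniformlyPi11 (g ∘ f)
lemma2p5 lem f g (φf , f≈φf) (φg , g≈φg) mono =
  compose φf φg , λ x n →
    ⇔-trans (Monotone⇒∈⇔∀⊈⊎∈ mono (f x) n) (⇔-sym (compose-sound φf φg f≈φf g≈φg x n))
  where open Classical lem
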